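{- Let $n\ge 1$ and let $\boldsymbol{\pi}\in\mathfrak{S}_n$ be written as a concatenation $\boldsymbol{\pi}=AB$, where $A$ is an initial segment and $B$ is the remaining final segment of $\boldsymbol{\pi}$, with the entries of $B$ in decreasing order. Then $\boldsymbol{\pi}$ is $(|A|+1)$-stack-sortable, i.e. $s^{|A|+1}(\boldsymbol{\pi})=\mathbf{e}$, where $|A|$ is the number of entries of $A$.
   Context: Permutations $\boldsymbol{\pi}=\pi_1\pi_2\cdots\pi_n\in\mathfrak{S}_n$ are written in one-line notation; $\mathbf{e}=12\cdots n$ is the identity. The stack-sorting map $s$ is defined as follows: start with an empty stack and read $\pi_1,\dots,\pi_n$ from left to right; for each $\pi_k$, while the stack is nonempty and its top element $t$ satisfies $t<\pi_k$, pop $t$ and append it to the output; then push $\pi_k$ onto the stack. After all entries are read, pop the remaining stack elements one at a time, appending each to the output. The output word is $s(\boldsymbol{\pi})$. $s^k$ denotes the $k$-fold iterate. $\boldsymbol{\pi}$ is called $k$-stack-sortable if $s^k(\boldsymbol{\pi})=\mathbf{e}$. -}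

module Defs where

open import Data.Nat using (ℕ; zero; suc; _<_; _>_)
open import Data.Nat.Properties using (_<?_)
open import Data.List using (List; []; _∷_; _++_; reverse)
open import Data.List.Relation.Binary.Permutation.Propositional using (_↭_)
open import Data.Product using (_×_; _,_)
open import Relation.Nullary using (yes; no)

idPerm : ℕ → List ℕ
idPerm n = go n []
  where
  go : ℕ → List ℕ → List ℕ
  go zero acc = acc
  go (suc k) acc = go k (suc k ∷ acc)

-- π is a permutation in S_n (one-line notation): a rearrangement of 1 ... n.
IsPerm : ℕ → List ℕ → Set
IsPerm n π = π ↭ idPerm n

-- Stack (head = top) and reversed output.
-- popLess x stack rout: while top t < x, pop t and append it to the output.
popLess : ℕ → List ℕ → List ℕ → List ℕ × List ℕ
popLess x [] rout = [] , rout
popLess x (t ∷ st) rout with t <? x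
... | yes _ = popLess x st (t ∷ rout)
... | no _  = t ∷ st , rout

stackRun : List ℕ → List ℕ → List ℕ → List ℕ
stackRun [] st rout = reverse rout ++ st
stackRun (x ∷ xs) st rout with popLess x st rout
... | st' , rout' = stackRun xs (x ∷ st') rout'

s : List ℕ → List ℕ
s π = stackRun π [] []

s^ : ℕ → List ℕ → List ℕ
s^ zero π = π
s^ (suc k) π = s (s^ k π)

StackSortable : ℕ → ℕ → List ℕ → Set
StackSortable n k π = s^ k π ≡ idPerm n
  where open import Relation.Binary.PropositionalEquality using (_≡_)

{-# OPTIONS --safe #-}

-- Run the stack machine on a word w: s w is the output produced while reading w
-- followed by the final stack, which is increasing from top to bottom.  The last
-- entry read is still on the stack, so fewer than |w| entries are output early.
-- If Q is increasing, reading it merges it with the sorted stack left by P, so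
-- s (P ++ Q) = P′ ++ Q′ with Q′ increasing and |P′| < |P|; hence s^|P| (P ++ Q)
-- is sorted.  If B is decreasing, no entry of B after the first pops anything, so
-- s (A ++ B) = P′ ++ (final stack) with |P′| ≤ |A|, and |A| more passes sort it.
-- A sorted permutation of 1 … n is the identity.
module Submission where

open import Defs
open import Data.Nat using (ℕ; suc; _≥_; _>_)
open import Data.List using (List; _++_; length)
open import Data.List.Relation.Unary.Linked using (Linked)
open import Relation.Binary.PropositionalEquality using (_≡_)

open import Data.Nat using (zero; pred; _+_; _≤_; _<_; z≤n; s≤s)
open import Data.Nat.Properties
  using (_<?_; ≤-totalOrder; ≤-refl; ≤-trans; <⇒≤; ≤⇒≯; ≮⇒≥; ≤-pred; n≤1+n; m<m+n;
         +-suc; +-identityʳ; pred[n]≤n; pred-mono-≤; module ≤-Reasoning)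
open import Data.List using ([]; _∷_; [_]; reverse; _ʳ++_; takeWhile; dropWhile)
open import Data.List.Properties
  using (++-assoc; ++-identityʳ; length-++; reverse-++; reverse-involutive; ʳ++-defn;
         takeWhile++dropWhile)
open import Data.List.Relation.Unary.Linked as Linked using ([-]; _∷_)
open import Data.List.Relation.Unary.Sorted.TotalOrder ≤-totalOrder using (Sorted)
open import Data.List.Relation.Unary.Sorted.TotalOrder.Properties using (↗↭↗⇒≋)
open import Data.List.Relation.Binary.Pointwise using (Pointwise-≡⇒≡)
open import Data.List.Relation.Binary.Permutation.Propositional
  using (_↭_; ↭-refl; ↭-trans; ↭⇒↭ₛ; module PermutationReasoning)
open import Data.List.Relation.Binary.Permutation.Propositional.Properties
  using (shift; ++⁺ˡ; ↭-length)
open import Data.Product using (_,_)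
open import Function using (_∘_)
open import Relation.Nullary using (yes; no; ¬_; contradiction)
open import Relation.Unary using (Pred; Decidable)
open import Level using (0ℓ)
open import Relation.Binary.PropositionalEquality
  using (refl; sym; trans; cong; cong₂; subst; module ≡-Reasoning)

-- The top of the stack is its head; unlike the accumulator of stackRun,
-- the output is kept in reading order.
record State : Set where
  constructor ⟨_,_⟩
  field
    stack  : List ℕ
    output : List ℕ

open State

initial : State
initial = ⟨ [] , [] ⟩

push : ℕ → State → State
push x ⟨ st , out ⟩ = ⟨ x ∷ dropWhile (_<? x) st , out ++ takeWhile (_<? x) st ⟩

run : List ℕ → State → State
run []       σ = σ
run (x ∷ xs) σ = run xs (push x σ)

flush : State → List ℕ
flush σ = output σ ++ stack σ

-- Stated for an abstract P?: a case split on t <? x does not unfold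
-- takeWhile (_<? x) (t ∷ st), whose test has already reduced to t <ᵇ x.
module _ {A : Set} {P : Pred A 0ℓ} (P? : Decidable P) {x : A} {xs : List A} where

  takeWhile-accept : P x → takeWhile P? (x ∷ xs) ≡ x ∷ takeWhile P? xs
  takeWhile-accept px with P? x
  ... | yes _  = refl
  ... | no ¬px = contradiction px ¬px

  takeWhile-reject : ¬ P x → takeWhile P? (x ∷ xs) ≡ []
  takeWhile-reject ¬px with P? x
  ... | yes px = contradiction px ¬px
  ... | no _   = refl

  dropWhile-accept : P x → dropWhile P? (x ∷ xs) ≡ dropWhile P? xs
  dropWhile-accept px with P? x
  ... | yes _  = refl
  ... | no ¬px = contradiction px ¬px

  dropWhile-reject : ¬ P x → dropWhile P? (x ∷ xs) ≡ x ∷ xs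
  dropWhile-reject ¬px with P? x
  ... | yes px = contradiction px ¬px
  ... | no _   = refl

popLess-takeWhile : ∀ x st r →
  popLess x st r ≡ (dropWhile (_<? x) st , takeWhile (_<? x) st ʳ++ r)
popLess-takeWhile x []       r = refl
popLess-takeWhile x (t ∷ st) r with t <? x
... | yes t<x = trans (popLess-takeWhile x st (t ∷ r))
      (sym (cong₂ _,_ (dropWhile-accept (_<? x) t<x)
                      (cong (_ʳ++ r) (takeWhile-accept (_<? x) t<x))))
... | no  t≮x = sym (cong₂ _,_ (dropWhile-reject (_<? x) t≮x)
                               (cong (_ʳ++ r) (takeWhile-reject (_<? x) t≮x)))

reverse-ʳ++ : ∀ {A : Set} (xs ys : List A) → reverse (xs ʳ++ ys) ≡ reverse ys ++ xs
reverse-ʳ++ xs ys = begin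
  reverse (xs ʳ++ ys)                  ≡⟨ cong reverse (ʳ++-defn xs) ⟩
  reverse (reverse xs ++ ys)           ≡⟨ reverse-++ (reverse xs) ys ⟩
  reverse ys ++ reverse (reverse xs)   ≡⟨ cong (reverse ys ++_) (reverse-involutive xs) ⟩
  reverse ys ++ xs                     ∎
  where open ≡-Reasoning

stackRun-run : ∀ xs st r → stackRun xs st r ≡ flush (run xs ⟨ st , reverse r ⟩)
stackRun-run []       st r = refl
stackRun-run (x ∷ xs) st r rewrite popLess-takeWhile x st r =
  trans (stackRun-run xs _ _)
        (cong (λ out → flush (run xs ⟨ _ , out ⟩)) (reverse-ʳ++ (takeWhile (_<? x) st) r))

s-flush-run : ∀ w → s w ≡ flush (run w initial)
s-flush-run w = stackRun-run w [] []

s^-suc : ∀ k w → s^ (suc k) w ≡ s^ k (s w)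
s^-suc zero    w = refl
s^-suc (suc k) w = cong s (s^-suc k w)

run-++ : ∀ xs ys σ → run (xs ++ ys) σ ≡ run ys (run xs σ)
run-++ []       ys σ = refl
run-++ (x ∷ xs) ys σ = run-++ xs ys (push x σ)

flush-run-output : ∀ xs st out → flush (run xs ⟨ st , out ⟩) ≡ out ++ flush (run xs ⟨ st , [] ⟩)
flush-run-output []       st out = refl
flush-run-output (x ∷ xs) st out = begin
  flush (run xs ⟨ st′ , out ++ popped ⟩)   ≡⟨ flush-run-output xs st′ (out ++ popped) ⟩
  (out ++ popped) ++ rest                  ≡⟨ ++-assoc out popped rest ⟩
  out ++ popped ++ rest                    ≡⟨ cong (out ++_) (flush-run-output xs st′ popped) ⟨
  out ++ flush (run xs ⟨ st′ , popped ⟩)   ∎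
  where
  open ≡-Reasoning
  st′ = x ∷ dropWhile (_<? x) st
  popped = takeWhile (_<? x) st
  rest = flush (run xs ⟨ st′ , [] ⟩)

flush-push-↭ : ∀ x σ → flush (push x σ) ↭ x ∷ flush σ
flush-push-↭ x ⟨ st , out ⟩ = begin
  (out ++ popped) ++ x ∷ kept   ↭⟨ shift x (out ++ popped) kept ⟩
  x ∷ (out ++ popped) ++ kept   ≡⟨ cong (x ∷_) (++-assoc out popped kept) ⟩
  x ∷ out ++ popped ++ kept     ≡⟨ cong (λ st′ → x ∷ out ++ st′) (takeWhile++dropWhile (_<? x) st) ⟩
  x ∷ out ++ st                 ∎
  where
  open PermutationReasoning
  popped = takeWhile (_<? x) st
  kept = dropWhile (_<? x) st

flush-run-↭ : ∀ xs σ → flush (run xs σ) ↭ xs ++ flush σ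
flush-run-↭ []       σ = ↭-refl
flush-run-↭ (x ∷ xs) σ = begin
  flush (run xs (push x σ))   ↭⟨ flush-run-↭ xs (push x σ) ⟩
  xs ++ flush (push x σ)      ↭⟨ ++⁺ˡ xs (flush-push-↭ x σ) ⟩
  xs ++ x ∷ flush σ           ↭⟨ shift x xs (flush σ) ⟩
  x ∷ xs ++ flush σ           ∎
  where open PermutationReasoning

s-↭ : ∀ w → s w ↭ w
s-↭ w = begin
  s w                       ≡⟨ s-flush-run w ⟩
  flush (run w initial)     ↭⟨ flush-run-↭ w initial ⟩
  w ++ []                   ≡⟨ ++-identityʳ w ⟩
  w                         ∎
  where open PermutationReasoning

s^-↭ : ∀ k w → s^ k w ↭ w
s^-↭ zero    w = ↭-refl
s^-↭ (suc k) w = ↭-trans (s-↭ (s^ k w)) (s^-↭ k w)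

length-flush-run : ∀ xs σ → length (flush (run xs σ)) ≡ length xs + length (flush σ)
length-flush-run xs σ = trans (↭-length (flush-run-↭ xs σ)) (length-++ xs)

stack-run-push-nonempty : ∀ xs x σ → 0 < length (stack (run xs (push x σ)))
stack-run-push-nonempty []       x σ = s≤s z≤n
stack-run-push-nonempty (y ∷ xs) x σ = stack-run-push-nonempty xs y (push x σ)

-- The element pushed last is still on the stack, so it is not yet output.
length-output-run-push : ∀ xs x σ →
  length (output (run xs (push x σ))) ≤ length xs + length (flush σ)
length-output-run-push xs x σ =
  ≤-pred (subst (length (output τ) <_) conservation
                (m<m+n (length (output τ)) (stack-run-push-nonempty xs x σ)))
  where
  open ≡-Reasoning
  τ = run xs (push x σ)
  conservation : length (output τ) + length (stack τ) ≡ suc (length xs + length (flush σ))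
  conservation = begin
    length (output τ) + length (stack τ)   ≡⟨ length-++ (output τ) ⟨
    length (flush τ)                       ≡⟨ length-flush-run xs (push x σ) ⟩
    length xs + length (flush (push x σ))  ≡⟨ cong (length xs +_) (↭-length (flush-push-↭ x σ)) ⟩
    length xs + suc (length (flush σ))     ≡⟨ +-suc (length xs) (length (flush σ)) ⟩
    suc (length xs + length (flush σ))     ∎

length-output-run-initial : ∀ w → length (output (run w initial)) ≤ pred (length w)
length-output-run-initial []       = z≤n
length-output-run-initial (x ∷ xs) =
  subst (length (output (run (x ∷ xs) initial)) ≤_) (+-identityʳ (length xs))
    (length-output-run-push xs x initial)

output-push-below-top : ∀ {x y st out} → y ≤ x → output (push y ⟨ x ∷ st , out ⟩) ≡ out
output-push-below-top {x} {y} {st} {out} y≤x =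
  trans (cong (out ++_) (takeWhile-reject (_<? y) (≤⇒≯ y≤x))) (++-identityʳ out)

output-run-decreasing : ∀ {x xs} σ → Linked _>_ (x ∷ xs) →
  output (run xs (push x σ)) ≡ output (push x σ)
output-run-decreasing σ [-]                = refl
output-run-decreasing σ (x>y ∷ ↘) =
  trans (output-run-decreasing (push _ σ) ↘) (output-push-below-top (<⇒≤ x>y))

≤-head-sorted : ∀ {q x xs} → q ≤ x → Sorted (x ∷ xs) → Sorted (q ∷ xs)
≤-head-sorted q≤x [-]           = [-]
≤-head-sorted q≤x (x≤y ∷ sorted) = ≤-trans q≤x x≤y ∷ sorted

sorted-0∷ : ∀ {xs} → Sorted xs → Sorted (0 ∷ xs)
sorted-0∷ Linked.[]         = [-]
sorted-0∷ [-]               = z≤n ∷ [-]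
sorted-0∷ (x≤y ∷ sorted)    = z≤n ∷ x≤y ∷ sorted

push-sorted : ∀ x {st} → Sorted st → Sorted (x ∷ dropWhile (_<? x) st)
push-sorted x Linked.[] = [-]
push-sorted x {t ∷ st} sorted with t <? x
... | yes t<x = subst (Sorted ∘ (x ∷_)) (sym (dropWhile-accept (_<? x) t<x))
                  (push-sorted x (Linked.tail sorted))
... | no  t≮x = subst (Sorted ∘ (x ∷_)) (sym (dropWhile-reject (_<? x) t≮x))
                  (≮⇒≥ t≮x ∷ sorted)

run-stack-sorted : ∀ xs σ → Sorted (stack σ) → Sorted (stack (run xs σ))
run-stack-sorted []       σ sorted = sorted
run-stack-sorted (x ∷ xs) σ sorted = run-stack-sorted xs (push x σ) (push-sorted x sorted)

takeWhile-++-sorted : ∀ {q x st ys} → Sorted (q ∷ st) → q ≤ x → Sorted (x ∷ ys) →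
  Sorted (q ∷ takeWhile (_<? x) st ++ ys)
takeWhile-++-sorted {st = []} _ q≤x x∷ys = ≤-head-sorted q≤x x∷ys
takeWhile-++-sorted {q} {x} {t ∷ st} {ys} q∷st q≤x x∷ys with t <? x
... | yes t<x = subst (λ zs → Sorted (q ∷ zs ++ ys)) (sym (takeWhile-accept (_<? x) t<x))
                  (Linked.head q∷st ∷ takeWhile-++-sorted (Linked.tail q∷st) (<⇒≤ t<x) x∷ys)
... | no  t≮x = subst (λ zs → Sorted (q ∷ zs ++ ys)) (sym (takeWhile-reject (_<? x) t≮x))
                  (≤-head-sorted q≤x x∷ys)

flush-run-increasing-sorted : ∀ {q st xs} → Sorted (q ∷ st) → Sorted (q ∷ xs) →
  Sorted (q ∷ flush (run xs ⟨ st , [] ⟩))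
flush-run-increasing-sorted q∷st [-] = q∷st
flush-run-increasing-sorted {q} {st} {x ∷ xs} q∷st (q≤x ∷ x∷xs) =
  subst (λ w → Sorted (q ∷ w))
    (sym (flush-run-output xs (x ∷ dropWhile (_<? x) st) (takeWhile (_<? x) st)))
    (takeWhile-++-sorted q∷st q≤x
      (flush-run-increasing-sorted (≤-refl ∷ push-sorted x (Linked.tail q∷st)) x∷xs))

s-++ : ∀ P Q →
  s (P ++ Q) ≡ output (run P initial) ++ flush (run Q ⟨ stack (run P initial) , [] ⟩)
s-++ P Q = begin
  s (P ++ Q)                      ≡⟨ s-flush-run (P ++ Q) ⟩
  flush (run (P ++ Q) initial)    ≡⟨ cong flush (run-++ P Q initial) ⟩
  flush (run Q (run P initial))   ≡⟨ flush-run-output Q _ _ ⟩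
  output (run P initial) ++ flush (run Q ⟨ stack (run P initial) , [] ⟩)  ∎
  where open ≡-Reasoning

s^-++-sorted : ∀ m P {Q} → Sorted Q → length P ≤ m → Sorted (s^ m (P ++ Q))
s^-++-sorted zero    []      Q↗ _       = Q↗
s^-++-sorted (suc m) P {Q} Q↗ |P|≤1+m =
  subst Sorted (sym (s^-suc m (P ++ Q)))
    (subst (Sorted ∘ s^ m) (sym (s-++ P Q))
      (s^-++-sorted m (output (run P initial)) merged↗
        (≤-trans (length-output-run-initial P) (pred-mono-≤ |P|≤1+m))))
  where
  merged↗ : Sorted (flush (run Q ⟨ stack (run P initial) , [] ⟩))
  merged↗ = Linked.tail (flush-run-increasing-sorted
    (sorted-0∷ (run-stack-sorted P initial Linked.[])) (sorted-0∷ Q↗))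

length-output-run-decreasing : ∀ A {B} → Linked _>_ B →
  length (output (run (A ++ B) initial)) ≤ length A
length-output-run-decreasing A {[]} _ = begin
  length (output (run (A ++ []) initial))  ≡⟨ cong (λ w → length (output (run w initial))) (++-identityʳ A) ⟩
  length (output (run A initial))          ≤⟨ length-output-run-initial A ⟩
  pred (length A)                          ≤⟨ pred[n]≤n ⟩
  length A                                 ∎
  where open ≤-Reasoning
length-output-run-decreasing A {b ∷ B} B↘ = begin
  length (output (run (A ++ b ∷ B) initial))  ≡⟨ cong (length ∘ output) (run-++ A (b ∷ B) initial) ⟩
  length (output (run B (push b σ)))          ≡⟨ cong length (output-run-decreasing σ B↘) ⟩
  length (output (push b σ))                  ≤⟨ length-output-run-push [] b σ ⟩
  length (flush σ)                            ≡⟨ length-flush-run A initial ⟩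
  length A + 0                                ≡⟨ +-identityʳ (length A) ⟩
  length A                                    ∎
  where
  open ≤-Reasoning
  σ = run A initial

s^-++-decreasing-sorted : ∀ A {B} → Linked _>_ B → Sorted (s^ (suc (length A)) (A ++ B))
s^-++-decreasing-sorted A {B} B↘ =
  subst Sorted (sym (s^-suc (length A) (A ++ B)))
    (subst (Sorted ∘ s^ (length A)) (sym (s-flush-run (A ++ B)))
      (s^-++-sorted (length A) (output σ) (run-stack-sorted (A ++ B) initial Linked.[])
        (length-output-run-decreasing A B↘)))
  where σ = run (A ++ B) initial

mutual
  -- The accumulator loop of idPerm is local to a where block of Defs; it is
  -- named here by solving a metavariable against the unfolding of idPerm.
  idPerm-loop : ℕ → ℕ → List ℕ → List ℕ
  idPerm-loop = _

  idPerm-suc : ∀ m → idPerm (suc m) ≡ idPerm-loop (suc m) m (suc m ∷ [])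
  idPerm-suc m with suc m
  ... | n with [ n ]
  ... | acc = refl

idPerm-loop-sorted : ∀ n k acc → Sorted (k ∷ acc) → Sorted (idPerm-loop n k acc)
idPerm-loop-sorted n zero    acc sorted = Linked.tail sorted
idPerm-loop-sorted n (suc k) acc sorted = idPerm-loop-sorted n k (suc k ∷ acc) (n≤1+n k ∷ sorted)

idPerm-sorted : ∀ n → Sorted (idPerm n)
idPerm-sorted zero    = Linked.[]
idPerm-sorted (suc m) =
  subst Sorted (sym (idPerm-suc m)) (idPerm-loop-sorted (suc m) m (suc m ∷ []) (n≤1+n m ∷ [-]))

sorted-↭-≡ : ∀ {xs ys} → Sorted xs → Sorted ys → xs ↭ ys → xs ≡ ys
sorted-↭-≡ xs↗ ys↗ xs↭ys = Pointwise-≡⇒≡ (↗↭↗⇒≋ ≤-totalOrder xs↗ ys↗ (↭⇒↭ₛ xs↭ys))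

corollary2p8 : (n : ℕ) → n ≥ 1 → (π A B : List ℕ) → IsPerm n π →
    π ≡ A ++ B → Linked _>_ B → StackSortable n (suc (length A)) π
corollary2p8 n _ π A B π↭e refl B↘ =
  sorted-↭-≡ (s^-++-decreasing-sorted A B↘) (idPerm-sorted n)
    (↭-trans (s^-↭ (suc (length A)) π) π↭e)
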